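{- For every $\sigma\in\mathfrak{S}_n$ and all $i,j\le n$, $\mathrm{fl}_i(\mathrm{fl}_j(\sigma))=\mathrm{fl}_j(\mathrm{fl}_i(\sigma))$.
   Context: $\mathfrak{S}_n$ is the set of permutations $\sigma=\sigma_1\cdots\sigma_n$ of $\{1,\ldots,n\}$ in one-line notation. For $\sigma\in\mathfrak{S}_n$ and $i\le n$, write $\{\sigma_1,\ldots,\sigma_i\}=\{a_1<a_2<\cdots<a_i\}$ and define $\mathrm{fl}_i(\sigma)\in\mathfrak{S}_n$ by $\mathrm{fl}_i(\sigma)_j=a_{i-t+1}$ if $j\le i$ and $\sigma_j=a_t$, and $\mathrm{fl}_i(\sigma)_j=\sigma_j$ for $j>i$. -}

module Defs where

open import Data.Nat using (ℕ; zero; suc; _∸_; _<ᵇ_)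
open import Data.Fin using (Fin; toℕ)
open import Data.Bool using (Bool; true; false; if_then_else_)
open import Data.List using (List; []; _∷_; filterᵇ; allFin; length)
open import Data.Bool.ListAction using (any)

-- A word σ₁⋯σₙ in one-line notation, 0-indexed: position k ↦ σ k.
Word : ℕ → Set
Word n = Fin n → Fin n

_<ᶠ_ : ∀ {n} → Fin n → Fin n → Bool
x <ᶠ y = toℕ x <ᵇ toℕ y

_==ᶠ_ : ∀ {n} → Fin n → Fin n → Bool
x ==ᶠ y = (toℕ x <ᵇ suc (toℕ y)) Data.Bool.∧ (toℕ y <ᵇ suc (toℕ x))

nth : ∀ {A : Set} → A → List A → ℕ → A
nth d []       _       = d
nth d (x ∷ xs) zero    = x
nth d (x ∷ xs) (suc k) = nth d xs k

-- The sorted list a₁ < a₂ < ⋯ < aᵢ of the values {σ₁,…,σᵢ}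
-- (positions 0,…,i-1 in 0-indexed form).
prefixSorted : ∀ {n} → ℕ → Word n → List (Fin n)
prefixSorted {n} i σ =
  filterᵇ (λ x → any (λ k → (toℕ k <ᵇ i) Data.Bool.∧ (σ k ==ᶠ x)) (allFin n)) (allFin n)

-- fl_i(σ): for position j < i with σ_j = a_t (t 1-based), output a_{i-t+1};
-- positions j ≥ i are unchanged.  With t₀ = t - 1 = #{a ∈ prefix : a < σ_j},
-- a_{i-t+1} is the entry with 0-based index i - 1 - t₀.
fl : ∀ {n} → ℕ → Word n → Word n
fl i σ j =
  if toℕ j <ᵇ i
  then nth (σ j) a (i ∸ 1 ∸ length (filterᵇ (λ x → x <ᶠ σ j) a))
  else σ j
  where a = prefixSorted i σ

-- Fix i ≤ j and let Sⱼ be the set of the first j values of τ. On the first j positions,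
-- fl j replaces τ by Φ ∘ τ, where Φ is the order-reversing involution of Sⱼ (the identity
-- outside Sⱼ). Since fl i only permutes the values of Sᵢ ⊆ Sⱼ among the first i positions,
-- fl j (fl i τ) = Φ ∘ fl i τ there. Conversely the first i values of fl j τ form Φ(Sᵢ), and
-- because Φ reverses the order on Sᵢ, the order reversal of Φ(Sᵢ) is Φ ∘ (reversal of Sᵢ) ∘ Φ;
-- hence fl i (fl j τ) = Φ ∘ fl i τ on the first j positions too. Beyond position j both sides are τ.
-- Ranks and sizes are counted as sums over Fin n, so that invariance of sums under
-- permutations transfers them along Φ.
module Submission where

open import Data.Bool using (Bool; true; false; _∧_; if_then_else_; T)
open import Data.Bool.Properties using (T-∧; T-≡; T?; ∧-zeroʳ; ∧-identityʳ)
open import Data.Bool.ListAction using (any)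
open import Data.Empty using (⊥-elim)
open import Data.Fin using (Fin; toℕ; zero; suc)
open import Data.Fin.Permutation using (Permutation′; _⟨$⟩ʳ_; _⟨$⟩ˡ_; permutation; inverseˡ)
open import Data.Fin.Properties using (toℕ-injective)
open import Data.List using (List; []; _∷_; filterᵇ; allFin; length; tabulate)
open import Data.List.Properties using (filter-accept; filter-reject; filter-none; filter-≐)
open import Data.List.Relation.Unary.All as All using (All; _∷_)
open import Data.List.Relation.Unary.All.Properties using (all-filter)
open import Data.List.Relation.Unary.AllPairs using (AllPairs; _∷_)
import Data.List.Relation.Unary.AllPairs.Properties as AllPairs
import Data.List.Relation.Unary.Any.Properties as Any
open import Data.Nat using (ℕ; zero; suc; _≤_; _<_; _∸_; _+_; _<ᵇ_; z≤n; s≤s; s≤s⁻¹)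
open import Data.Nat.Properties
open import Data.Product using (∃; _×_; _,_; proj₁; proj₂)
open import Data.Sum using (inj₁; inj₂)
open import Function using (_∘_)
open import Function.Bundles using (Equivalence)
open import Relation.Binary.Definitions using (tri<; tri≈; tri>)
open import Relation.Binary.PropositionalEquality
open import Relation.Nullary using (¬_; yes; no)

open import Defs

open import Algebra.Properties.CommutativeMonoid.Sum +-0-commutativeMonoid
  using (sum; sum-cong-≗; sum-permute; ∑-distrib-+; sum-replicate-zero)

T⇒≡true : ∀ {b} → T b → b ≡ true
T⇒≡true = Equivalence.to T-≡

¬T⇒≡false : ∀ {b} → ¬ T b → b ≡ false
¬T⇒≡false {false} _  = refl
¬T⇒≡false {true}  ¬b = ⊥-elim (¬b _)

T-extensional : ∀ {a b} → (T a → T b) → (T b → T a) → a ≡ b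
T-extensional {false} {false} _   _   = refl
T-extensional {false} {true}  _   b⇒a = ⊥-elim (b⇒a _)
T-extensional {true}  {false} a⇒b _   = ⊥-elim (a⇒b _)
T-extensional {true}  {true}  _   _   = refl

∧-intro : ∀ {a b} → T a → T b → T (a ∧ b)
∧-intro a b = Equivalence.from T-∧ (a , b)

∧-elim : ∀ {a b} → T (a ∧ b) → T a × T b
∧-elim = Equivalence.to T-∧

<ᶠ⇒< : ∀ {n} {x y : Fin n} → T (x <ᶠ y) → toℕ x < toℕ y
<ᶠ⇒< {x = x} {y} = <ᵇ⇒< (toℕ x) (toℕ y)

<⇒<ᶠ : ∀ {n} {x y : Fin n} → toℕ x < toℕ y → T (x <ᶠ y)
<⇒<ᶠ = <⇒<ᵇ

<ᶠ-irrefl : ∀ {n} (x : Fin n) → ¬ T (x <ᶠ x)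
<ᶠ-irrefl x = <-irrefl refl ∘ <ᶠ⇒< {x = x} {x}

==ᶠ⇒≡ : ∀ {n} {x y : Fin n} → T (x ==ᶠ y) → x ≡ y
==ᶠ⇒≡ {x = x} {y} x==y with ∧-elim {toℕ x <ᵇ suc (toℕ y)} x==y
... | x≤y , y≤x = toℕ-injective (≤-antisym (s≤s⁻¹ (<ᵇ⇒< _ _ x≤y)) (s≤s⁻¹ (<ᵇ⇒< _ _ y≤x)))

==ᶠ-refl : ∀ {n} (x : Fin n) → T (x ==ᶠ x)
==ᶠ-refl x = ∧-intro (<⇒<ᵇ (n<1+n (toℕ x))) (<⇒<ᵇ (n<1+n (toℕ x)))

-- Counting subsets of Fin n

𝟙 : Bool → ℕ
𝟙 true  = 1
𝟙 false = 0

count : ∀ {n} → (Fin n → Bool) → ℕ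
count p = sum (λ k → 𝟙 (p k))

count-cong : ∀ {n} {p q : Fin n → Bool} → p ≗ q → count p ≡ count q
count-cong p≗q = sum-cong-≗ (cong 𝟙 ∘ p≗q)

count-permute : ∀ {n} (p : Fin n → Bool) (π : Permutation′ n) → count p ≡ count (p ∘ (π ⟨$⟩ʳ_))
count-permute p π = sum-permute (λ k → 𝟙 (p k)) π

count-∘-involution : ∀ {n} (p : Fin n → Bool) {Φ : Fin n → Fin n} →
  (∀ x → Φ (Φ x) ≡ x) → count (p ∘ Φ) ≡ count p
count-∘-involution p {Φ} Φ-involutive =
  trans (count-permute (p ∘ Φ) (permutation Φ Φ Φ-involutive Φ-involutive))
        (count-cong (cong p ∘ Φ-involutive))

𝟙-mono : ∀ {a b} → (T a → T b) → 𝟙 a ≤ 𝟙 b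
𝟙-mono {false}        _   = z≤n
𝟙-mono {true} {true}  _   = ≤-refl
𝟙-mono {true} {false} a⇒b = ⊥-elim (a⇒b _)

𝟙-mono-< : ∀ {a b} → ¬ T a → T b → 𝟙 a < 𝟙 b
𝟙-mono-< {false} {true} _  _ = s≤s z≤n
𝟙-mono-< {true}         ¬a _ = ⊥-elim (¬a _)

count-mono : ∀ {n} {p q : Fin n → Bool} → (∀ k → T (p k) → T (q k)) → count p ≤ count q
count-mono {zero}  _   = z≤n
count-mono {suc n} p⇒q = +-mono-≤ (𝟙-mono (p⇒q zero)) (count-mono (p⇒q ∘ suc))

count-mono-< : ∀ {n} {p q : Fin n → Bool} → (∀ k → T (p k) → T (q k)) →
  ∀ w → ¬ T (p w) → T (q w) → count p < count q
count-mono-< {suc n} p⇒q zero    ¬pw qw =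
  +-mono-<-≤ (𝟙-mono-< ¬pw qw) (count-mono (p⇒q ∘ suc))
count-mono-< {suc n} p⇒q (suc w) ¬pw qw =
  +-mono-≤-< (𝟙-mono (p⇒q zero)) (count-mono-< (p⇒q ∘ suc) w ¬pw qw)

count-below : ∀ n {i} → i ≤ n → count {n} (λ k → toℕ k <ᵇ i) ≡ i
count-below n       z≤n       = sum-replicate-zero n
count-below (suc n) (s≤s i≤n) = cong suc (count-below n i≤n)

count-==ᶠ : ∀ {n} (y : Fin n) → count (_==ᶠ y) ≡ 1
count-==ᶠ {suc n} zero    = cong suc (sum-replicate-zero n)
count-==ᶠ {suc n} (suc y) = count-==ᶠ y

𝟙-∧-partition : ∀ b {x y z} → 𝟙 x + 𝟙 y + 𝟙 z ≡ 1 → 𝟙 b ≡ 𝟙 (b ∧ x) + 𝟙 (b ∧ y) + 𝟙 (b ∧ z)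
𝟙-∧-partition true  xyz≡1 = sym xyz≡1
𝟙-∧-partition false _     = refl

𝟙-trichotomy : ∀ {n} (x y : Fin n) → 𝟙 (y <ᶠ x) + 𝟙 (x <ᶠ y) + 𝟙 (x ==ᶠ y) ≡ 1
𝟙-trichotomy x y with <-cmp (toℕ x) (toℕ y)
... | tri< x<y x≢y x≯y
  rewrite ¬T⇒≡false (x≯y ∘ <ᶠ⇒< {x = y}) | T⇒≡true (<⇒<ᶠ {x = x} x<y)
        | ¬T⇒≡false (x≢y ∘ cong toℕ ∘ ==ᶠ⇒≡ {x = x} {y}) = refl
... | tri≈ _ x≡y _
  rewrite toℕ-injective x≡y | ¬T⇒≡false (<ᶠ-irrefl y) | T⇒≡true (==ᶠ-refl y) = refl
... | tri> x≮y x≢y x>y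
  rewrite T⇒≡true (<⇒<ᶠ {x = y} x>y) | ¬T⇒≡false (x≮y ∘ <ᶠ⇒< {x = x})
        | ¬T⇒≡false (x≢y ∘ cong toℕ ∘ ==ᶠ⇒≡ {x = x} {y}) = refl

length-filterᵇ-tabulate : ∀ {A : Set} {n} (p : A → Bool) (f : Fin n → A) →
  length (filterᵇ p (tabulate f)) ≡ count (p ∘ f)
length-filterᵇ-tabulate {n = zero}  p f = refl
length-filterᵇ-tabulate {n = suc n} p f with p (f zero)
... | true  = cong suc (length-filterᵇ-tabulate p (f ∘ suc))
... | false = length-filterᵇ-tabulate p (f ∘ suc)

length-filterᵇ-filterᵇ : ∀ {A : Set} (p q : A → Bool) xs →
  length (filterᵇ q (filterᵇ p xs)) ≡ length (filterᵇ (λ x → p x ∧ q x) xs)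
length-filterᵇ-filterᵇ p q []       = refl
length-filterᵇ-filterᵇ p q (x ∷ xs) with p x
... | false = length-filterᵇ-filterᵇ p q xs
... | true with q x
...   | true  = cong suc (length-filterᵇ-filterᵇ p q xs)
...   | false = length-filterᵇ-filterᵇ p q xs

StrictlyIncreasing : ∀ {n} → List (Fin n) → Set
StrictlyIncreasing = AllPairs (λ x y → toℕ x < toℕ y)

nth-All : ∀ {A : Set} {P : A → Set} (d : A) {xs : List A} {t} →
  All P xs → t < length xs → P (nth d xs t)
nth-All d {t = zero}  (px ∷ _)   _        = px
nth-All d {t = suc t} (_  ∷ pxs) (s≤s t<) = nth-All d pxs t<

length-filterᵇ-<ᶠ-nth : ∀ {n} (d : Fin n) {xs t} → StrictlyIncreasing xs → t < length xs →
  length (filterᵇ (_<ᶠ nth d xs t) xs) ≡ t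
length-filterᵇ-<ᶠ-nth d {x ∷ xs} {zero} (x<xs ∷ _) _ = begin
  length (filterᵇ (_<ᶠ x) (x ∷ xs)) ≡⟨ cong length (filter-reject (T? ∘ (_<ᶠ x)) (<ᶠ-irrefl x)) ⟩
  length (filterᵇ (_<ᶠ x) xs)       ≡⟨ cong length (filter-none (T? ∘ (_<ᶠ x)) (All.map ≮x x<xs)) ⟩
  0                                  ∎
  where
  open ≡-Reasoning
  ≮x : ∀ {y} → toℕ x < toℕ y → ¬ T (y <ᶠ x)
  ≮x {y} x<y y<x = <-asym x<y (<ᶠ⇒< {x = y} y<x)
length-filterᵇ-<ᶠ-nth d {x ∷ xs} {suc t} (x<xs ∷ xs↑) (s≤s t<) = begin
  length (filterᵇ (_<ᶠ y) (x ∷ xs)) ≡⟨ cong length (filter-accept (T? ∘ (_<ᶠ y)) x<y) ⟩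
  suc (length (filterᵇ (_<ᶠ y) xs)) ≡⟨ cong suc (length-filterᵇ-<ᶠ-nth d xs↑ t<) ⟩
  suc t                              ∎
  where
  open ≡-Reasoning
  y = nth d xs t
  x<y : T (x <ᶠ y)
  x<y = <⇒<ᶠ {x = x} (nth-All d x<xs t<)

-- Rank and order reversal within a subset S = {a₁ < ⋯ < aₛ} of Fin n

sorted : ∀ {n} → (Fin n → Bool) → List (Fin n)
sorted {n} S = filterᵇ S (allFin n)

size : ∀ {n} → (Fin n → Bool) → ℕ
size S = length (sorted S)

rank : ∀ {n} → (Fin n → Bool) → Fin n → ℕ
rank S x = length (filterᵇ (_<ᶠ x) (sorted S))

corank : ∀ {n} → (Fin n → Bool) → Fin n → ℕ
corank S x = count (λ k → S k ∧ x <ᶠ k)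

-- mirror S aₜ = aₛ₊₁₋ₜ; its value outside S is junk. This is the shape of fl in Defs.
mirror : ∀ {n} → (Fin n → Bool) → Fin n → Fin n
mirror S x = nth x (sorted S) (size S ∸ 1 ∸ rank S x)

sorted-⊆ : ∀ {n} (S : Fin n → Bool) → All (T ∘ S) (sorted S)
sorted-⊆ {n} S = all-filter (T? ∘ S) (allFin n)

sorted-increasing : ∀ {n} (S : Fin n → Bool) → StrictlyIncreasing (sorted S)
sorted-increasing S = AllPairs.filter⁺ (T? ∘ S) (AllPairs.tabulate⁺-< (λ i<j → i<j))

sorted-cong : ∀ {n} {S S′ : Fin n → Bool} → S ≗ S′ → sorted S ≡ sorted S′
sorted-cong {n} S≗S′ = filter-≐ (T? ∘ _) (T? ∘ _)
  ((λ {x} → subst T (S≗S′ x)) , (λ {x} → subst T (sym (S≗S′ x)))) (allFin n)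

size-cong : ∀ {n} {S S′ : Fin n → Bool} → S ≗ S′ → size S ≡ size S′
size-cong S≗S′ = cong length (sorted-cong S≗S′)

mirror-cong : ∀ {n} {S S′ : Fin n → Bool} → S ≗ S′ → ∀ x → mirror S x ≡ mirror S′ x
mirror-cong S≗S′ x =
  cong (λ xs → nth x xs (length xs ∸ 1 ∸ length (filterᵇ (_<ᶠ x) xs))) (sorted-cong S≗S′)

size-count : ∀ {n} (S : Fin n → Bool) → size S ≡ count S
size-count S = length-filterᵇ-tabulate S (λ k → k)

rank-count : ∀ {n} (S : Fin n → Bool) x → rank S x ≡ count (λ k → S k ∧ k <ᶠ x)
rank-count {n} S x = trans (length-filterᵇ-filterᵇ S (_<ᶠ x) (allFin n))
                           (length-filterᵇ-tabulate (λ k → S k ∧ k <ᶠ x) (λ k → k))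

rank<size : ∀ {n} (S : Fin n → Bool) {x} → T (S x) → rank S x < size S
rank<size S {x} x∈S rewrite rank-count S x | size-count S =
  count-mono-< (λ k → proj₁ ∘ ∧-elim {S k}) x (<ᶠ-irrefl x ∘ proj₂ ∘ ∧-elim {S x}) x∈S

rank-strictMono : ∀ {n} (S : Fin n → Bool) {x y} → T (S x) → toℕ x < toℕ y → rank S x < rank S y
rank-strictMono S {x} {y} x∈S x<y rewrite rank-count S x | rank-count S y =
  count-mono-< below-x⇒below-y x (<ᶠ-irrefl x ∘ proj₂ ∘ ∧-elim {S x}) (∧-intro x∈S (<⇒<ᶠ {x = x} x<y))
  where
  below-x⇒below-y : ∀ k → T (S k ∧ k <ᶠ x) → T (S k ∧ k <ᶠ y)
  below-x⇒below-y k k∈ with ∧-elim {S k} k∈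
  ... | k∈S , k<x = ∧-intro k∈S (<⇒<ᶠ {x = k} (<-trans (<ᶠ⇒< {x = k} k<x) x<y))

rank-injective : ∀ {n} (S : Fin n → Bool) {x y} → T (S x) → T (S y) → rank S x ≡ rank S y → x ≡ y
rank-injective S {x} {y} x∈S y∈S rx≡ry with <-cmp (toℕ x) (toℕ y)
... | tri< x<y _ _ = ⊥-elim (<-irrefl rx≡ry (rank-strictMono S x∈S x<y))
... | tri≈ _ x≡y _ = toℕ-injective x≡y
... | tri> _ _ y<x = ⊥-elim (<-irrefl (sym rx≡ry) (rank-strictMono S y∈S y<x))

rank-reflects-< : ∀ {n} (S : Fin n → Bool) {x y} → T (S x) → T (S y) →
  rank S x < rank S y → toℕ x < toℕ y
rank-reflects-< S {x} {y} x∈S y∈S rx<ry with <-cmp (toℕ x) (toℕ y)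
... | tri< x<y _ _ = x<y
... | tri≈ _ x≡y _ = ⊥-elim (<-irrefl (cong (rank S) (toℕ-injective x≡y)) rx<ry)
... | tri> _ _ y<x = ⊥-elim (<-asym rx<ry (rank-strictMono S y∈S y<x))

size≡corank+rank+1 : ∀ {n} (S : Fin n → Bool) {y} → T (S y) → size S ≡ corank S y + rank S y + 1
size≡corank+rank+1 S {y} y∈S = begin
  size S
    ≡⟨ size-count S ⟩
  count S
    ≡⟨ sum-cong-≗ (λ k → 𝟙-∧-partition (S k) (𝟙-trichotomy k y)) ⟩
  sum (λ k → 𝟙 (S k ∧ y <ᶠ k) + 𝟙 (S k ∧ k <ᶠ y) + 𝟙 (S k ∧ k ==ᶠ y))
    ≡⟨ ∑-distrib-+ (λ k → 𝟙 (S k ∧ y <ᶠ k) + 𝟙 (S k ∧ k <ᶠ y)) _ ⟩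
  sum (λ k → 𝟙 (S k ∧ y <ᶠ k) + 𝟙 (S k ∧ k <ᶠ y)) + count (λ k → S k ∧ k ==ᶠ y)
    ≡⟨ cong₂ _+_ (∑-distrib-+ (λ k → 𝟙 (S k ∧ y <ᶠ k)) _) (count-cong at-y) ⟩
  corank S y + count (λ k → S k ∧ k <ᶠ y) + count (_==ᶠ y)
    ≡⟨ cong₂ (λ r c → corank S y + r + c) (sym (rank-count S y)) (count-==ᶠ y) ⟩
  corank S y + rank S y + 1
    ∎
  where
  open ≡-Reasoning
  at-y : ∀ k → (S k ∧ k ==ᶠ y) ≡ (k ==ᶠ y)
  at-y k with k ==ᶠ y in k==y
  ... | false = ∧-zeroʳ (S k)
  ... | true rewrite ==ᶠ⇒≡ {x = k} {y} (subst T (sym k==y) _) =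
    trans (∧-identityʳ (S y)) (T⇒≡true y∈S)

corank-rank : ∀ {n} (S : Fin n → Bool) {y} → T (S y) → corank S y ≡ size S ∸ 1 ∸ rank S y
corank-rank S {y} y∈S = sym (begin
  size S ∸ 1 ∸ rank S y                    ≡⟨ cong (λ s → s ∸ 1 ∸ rank S y) (size≡corank+rank+1 S y∈S) ⟩
  corank S y + rank S y + 1 ∸ 1 ∸ rank S y ≡⟨ cong (_∸ rank S y) (m+n∸n≡m (corank S y + rank S y) 1) ⟩
  corank S y + rank S y ∸ rank S y         ≡⟨ m+n∸n≡m (corank S y) (rank S y) ⟩
  corank S y                               ∎)
  where open ≡-Reasoning

private
  mirrored-index< : ∀ r m → r < m → m ∸ 1 ∸ r < m
  mirrored-index< r (suc m) _ = s≤s (m∸n≤m m r)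

  <⇒≤∸1 : ∀ {r m} → r < m → r ≤ m ∸ 1
  <⇒≤∸1 (s≤s r≤m) = r≤m

mirror-∈ : ∀ {n} (S : Fin n → Bool) {x} → T (S x) → T (S (mirror S x))
mirror-∈ S {x} x∈S = nth-All x (sorted-⊆ S) (mirrored-index< _ _ (rank<size S x∈S))

rank-mirror : ∀ {n} (S : Fin n → Bool) {x} → T (S x) → rank S (mirror S x) ≡ size S ∸ 1 ∸ rank S x
rank-mirror S {x} x∈S =
  length-filterᵇ-<ᶠ-nth x (sorted-increasing S) (mirrored-index< _ _ (rank<size S x∈S))

mirror-involutive : ∀ {n} (S : Fin n → Bool) {x} → T (S x) → mirror S (mirror S x) ≡ x
mirror-involutive S {x} x∈S = rank-injective S (mirror-∈ S (mirror-∈ S x∈S)) x∈S (begin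
  rank S (mirror S (mirror S x))       ≡⟨ rank-mirror S (mirror-∈ S x∈S) ⟩
  size S ∸ 1 ∸ rank S (mirror S x)     ≡⟨ cong (size S ∸ 1 ∸_) (rank-mirror S x∈S) ⟩
  size S ∸ 1 ∸ (size S ∸ 1 ∸ rank S x) ≡⟨ m∸[m∸n]≡n (<⇒≤∸1 (rank<size S x∈S)) ⟩
  rank S x                             ∎)
  where open ≡-Reasoning

mirror-antitone : ∀ {n} (S : Fin n → Bool) {x y} → T (S x) → T (S y) →
  toℕ x < toℕ y → toℕ (mirror S y) < toℕ (mirror S x)
mirror-antitone S {x} {y} x∈S y∈S x<y =
  rank-reflects-< S (mirror-∈ S y∈S) (mirror-∈ S x∈S)
    (subst₂ _<_ (sym (rank-mirror S y∈S)) (sym (rank-mirror S x∈S))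
      (reverse-< (rank-strictMono S x∈S x<y) (rank<size S y∈S)))
  where
  reverse-< : ∀ {a b m} → a < b → b < m → m ∸ 1 ∸ b < m ∸ 1 ∸ a
  reverse-< a<b (s≤s b≤m) = ∸-monoʳ-< a<b b≤m

module OrderReversal {n} (Φ : Fin n → Fin n) (Φ-involutive : ∀ x → Φ (Φ x) ≡ x)
  (S : Fin n → Bool)
  (Φ-antitone : ∀ {x y} → T (S x) → T (S y) → toℕ x < toℕ y → toℕ (Φ y) < toℕ (Φ x)) where

  size-∘ : size (S ∘ Φ) ≡ size S
  size-∘ = trans (size-count (S ∘ Φ)) (trans (count-∘-involution S Φ-involutive) (sym (size-count S)))

  <ᶠ-Φ : ∀ {x y} → T (S x) → T (S y) → (Φ x <ᶠ Φ y) ≡ (y <ᶠ x)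
  <ᶠ-Φ {x} {y} x∈S y∈S =
    T-extensional Φx<Φy⇒y<x (<⇒<ᶠ {x = Φ x} ∘ Φ-antitone y∈S x∈S ∘ <ᶠ⇒< {x = y})
    where
    Φx<Φy⇒y<x : T (Φ x <ᶠ Φ y) → T (y <ᶠ x)
    Φx<Φy⇒y<x Φx<Φy with <-cmp (toℕ y) (toℕ x)
    ... | tri< y<x _ _ = <⇒<ᶠ {x = y} y<x
    ... | tri≈ _ y≡x _ rewrite toℕ-injective y≡x = ⊥-elim (<ᶠ-irrefl (Φ x) Φx<Φy)
    ... | tri> _ _ x<y = ⊥-elim (<-asym (<ᶠ⇒< {x = Φ x} Φx<Φy) (Φ-antitone x∈S y∈S x<y))

  rank-∘ : ∀ {y} → T (S y) → rank (S ∘ Φ) (Φ y) ≡ corank S y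
  rank-∘ {y} y∈S = begin
    rank (S ∘ Φ) (Φ y)                     ≡⟨ rank-count (S ∘ Φ) (Φ y) ⟩
    count (λ k → S (Φ k) ∧ k <ᶠ Φ y)       ≡⟨ count-∘-involution (λ k → S (Φ k) ∧ k <ᶠ Φ y) Φ-involutive ⟨
    count (λ k → S (Φ (Φ k)) ∧ Φ k <ᶠ Φ y) ≡⟨ count-cong reversed ⟩
    corank S y                             ∎
    where
    open ≡-Reasoning
    reversed : ∀ k → (S (Φ (Φ k)) ∧ Φ k <ᶠ Φ y) ≡ (S k ∧ y <ᶠ k)
    reversed k rewrite Φ-involutive k with S k in k∈S
    ... | true  = <ᶠ-Φ (subst T (sym k∈S) _) y∈S
    ... | false = refl

  mirror-∘ : ∀ {x} → T (S x) → mirror (S ∘ Φ) (Φ x) ≡ Φ (mirror S x)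
  mirror-∘ {x} x∈S = rank-injective (S ∘ Φ) (mirror-∈ (S ∘ Φ) Φx∈) Φx̄∈ (begin
    rank (S ∘ Φ) (mirror (S ∘ Φ) (Φ x))   ≡⟨ rank-mirror (S ∘ Φ) Φx∈ ⟩
    size (S ∘ Φ) ∸ 1 ∸ rank (S ∘ Φ) (Φ x) ≡⟨ cong₂ (λ s r → s ∸ 1 ∸ r) size-∘ (rank-∘ x∈S) ⟩
    size S ∸ 1 ∸ corank S x               ≡⟨ cong (size S ∸ 1 ∸_) (corank-rank S x∈S) ⟩
    size S ∸ 1 ∸ (size S ∸ 1 ∸ rank S x)  ≡⟨ cong (size S ∸ 1 ∸_) (rank-mirror S x∈S) ⟨
    size S ∸ 1 ∸ rank S (mirror S x)      ≡⟨ corank-rank S (mirror-∈ S x∈S) ⟨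
    corank S (mirror S x)                 ≡⟨ rank-∘ (mirror-∈ S x∈S) ⟨
    rank (S ∘ Φ) (Φ (mirror S x))         ∎)
    where
    open ≡-Reasoning
    Φx∈ : T (S (Φ (Φ x)))
    Φx∈ = subst (T ∘ S) (sym (Φ-involutive x)) x∈S
    Φx̄∈ : T (S (Φ (Φ (mirror S x))))
    Φx̄∈ = subst (T ∘ S) (sym (Φ-involutive _)) (mirror-∈ S x∈S)

-- The predicate of prefixSorted in Defs, so that prefixSorted i τ is sorted (prefix i τ).
prefix : ∀ {n} → ℕ → (Fin n → Fin n) → Fin n → Bool
prefix {n} i τ x = any (λ k → (toℕ k <ᵇ i) ∧ (τ k ==ᶠ x)) (allFin n)

prefix-intro : ∀ {n} {i} (τ : Fin n → Fin n) {k} → toℕ k < i → T (prefix i τ (τ k))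
prefix-intro τ {k} k<i = Any.any⁺ _ (Any.tabulate⁺ k (∧-intro (<⇒<ᵇ k<i) (==ᶠ-refl (τ k))))

prefix-elim : ∀ {n} {i} (τ : Fin n → Fin n) {x} → T (prefix i τ x) → ∃ λ k → toℕ k < i × τ k ≡ x
prefix-elim τ x∈ with Any.tabulate⁻ (Any.any⁻ _ _ x∈)
... | k , k<i∧τk==x with ∧-elim k<i∧τk==x
...   | k<i , τk==x = k , <ᵇ⇒< _ _ k<i , ==ᶠ⇒≡ {x = τ k} τk==x

prefix-mono : ∀ {n} {i j} (τ : Fin n → Fin n) {x} → i ≤ j → T (prefix i τ x) → T (prefix j τ x)
prefix-mono τ {x} i≤j x∈ with prefix-elim τ {x} x∈
... | k , k<i , refl = prefix-intro τ (<-≤-trans k<i i≤j)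

size-prefix-permutation : ∀ {n} (σ : Permutation′ n) {i} → i ≤ n → size (prefix i (σ ⟨$⟩ʳ_)) ≡ i
size-prefix-permutation {n} σ {i} i≤n = begin
  size (prefix i τ)            ≡⟨ size-count (prefix i τ) ⟩
  count (prefix i τ)           ≡⟨ count-permute (prefix i τ) σ ⟩
  count (prefix i τ ∘ τ)       ≡⟨ count-cong τk∈⇔k< ⟩
  count {n} (λ k → toℕ k <ᵇ i) ≡⟨ count-below n i≤n ⟩
  i                            ∎
  where
  open ≡-Reasoning
  τ = σ ⟨$⟩ʳ_
  position< : ∀ k → T (prefix i τ (τ k)) → toℕ k < i
  position< k τk∈ with prefix-elim τ τk∈
  ... | k′ , k′<i , τk′≡τk = subst (λ m → toℕ m < i)
    (trans (sym (inverseˡ σ)) (trans (cong (σ ⟨$⟩ˡ_) τk′≡τk) (inverseˡ σ))) k′<i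
  τk∈⇔k< : ∀ k → prefix i τ (τ k) ≡ (toℕ k <ᵇ i)
  τk∈⇔k< k = T-extensional (<⇒<ᵇ ∘ position< k) (prefix-intro τ {k} ∘ <ᵇ⇒< (toℕ k) i)

fl-below : ∀ {n} {i} (τ : Fin n → Fin n) {p} → size (prefix i τ) ≡ i → toℕ p < i →
  fl i τ p ≡ mirror (prefix i τ) (τ p)
fl-below τ size≡i p<i rewrite T⇒≡true (<⇒<ᵇ p<i) | size≡i = refl

fl-above : ∀ {n} {i} (τ : Fin n → Fin n) {p} → ¬ toℕ p < i → fl i τ p ≡ τ p
fl-above τ p≮i rewrite ¬T⇒≡false (p≮i ∘ <ᵇ⇒< _ _) = refl

-- Commutation of fl i and fl j for i ≤ j

module Commutation {n} (τ : Fin n → Fin n) (size-prefix : ∀ {i} → i ≤ n → size (prefix i τ) ≡ i)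
  {i j} (i≤j : i ≤ j) (j≤n : j ≤ n) where

  Sᵢ Sⱼ : Fin n → Bool
  Sᵢ = prefix i τ
  Sⱼ = prefix j τ

  Φ : Fin n → Fin n
  Φ x = if Sⱼ x then mirror Sⱼ x else x

  Φ-∈ : ∀ {x} → T (Sⱼ x) → Φ x ≡ mirror Sⱼ x
  Φ-∈ x∈ rewrite T⇒≡true x∈ = refl

  Φ-involutive : ∀ x → Φ (Φ x) ≡ x
  Φ-involutive x with Sⱼ x in x∈Sⱼ
  ... | true  = let x∈ = subst T (sym x∈Sⱼ) _ in
                trans (Φ-∈ (mirror-∈ Sⱼ x∈)) (mirror-involutive Sⱼ x∈)
  ... | false rewrite x∈Sⱼ = refl

  Φ-antitone : ∀ {x y} → T (Sᵢ x) → T (Sᵢ y) → toℕ x < toℕ y → toℕ (Φ y) < toℕ (Φ x)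
  Φ-antitone x∈ y∈ x<y rewrite Φ-∈ (prefix-mono τ i≤j x∈) | Φ-∈ (prefix-mono τ i≤j y∈) =
    mirror-antitone Sⱼ (prefix-mono τ i≤j x∈) (prefix-mono τ i≤j y∈) x<y

  open OrderReversal Φ Φ-involutive Sᵢ Φ-antitone

  fl-i-below : ∀ {p} → toℕ p < i → fl i τ p ≡ mirror Sᵢ (τ p)
  fl-i-below = fl-below τ (size-prefix (≤-trans i≤j j≤n))

  fl-j-below : ∀ {p} → toℕ p < j → fl j τ p ≡ Φ (τ p)
  fl-j-below p<j = trans (fl-below τ (size-prefix j≤n) p<j) (sym (Φ-∈ (prefix-intro τ p<j)))

  fl-i-∈ : ∀ {p} → toℕ p < j → T (Sⱼ (fl i τ p))
  fl-i-∈ {p} p<j with toℕ p <? i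
  ... | yes p<i = subst (T ∘ Sⱼ) (sym (fl-i-below p<i))
                    (prefix-mono τ i≤j (mirror-∈ Sᵢ (prefix-intro τ p<i)))
  ... | no  p≮i = subst (T ∘ Sⱼ) (sym (fl-above τ p≮i)) (prefix-intro τ p<j)

  prefix-j-fl-i : prefix j (fl i τ) ≗ Sⱼ
  prefix-j-fl-i x = T-extensional to from
    where
    to : T (prefix j (fl i τ) x) → T (Sⱼ x)
    to x∈ with prefix-elim (fl i τ) {x} x∈
    ... | p , p<j , refl = fl-i-∈ p<j
    from : T (Sⱼ x) → T (prefix j (fl i τ) x)
    from x∈ with prefix-elim {i = j} τ {x} x∈
    ... | p , p<j , refl with toℕ p <? i
    ...   | no p≮i = subst (T ∘ prefix j (fl i τ)) (fl-above τ p≮i) (prefix-intro (fl i τ) {p} p<j)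
    ...   | yes p<i with prefix-elim τ (mirror-∈ Sᵢ (prefix-intro τ p<i))
    ...     | q , q<i , τq≡x̄ = subst (T ∘ prefix j (fl i τ))
                (trans (fl-i-below q<i)
                  (trans (cong (mirror Sᵢ) τq≡x̄) (mirror-involutive Sᵢ (prefix-intro τ p<i))))
                (prefix-intro (fl i τ) (<-≤-trans q<i i≤j))

  prefix-i-fl-j : prefix i (fl j τ) ≗ Sᵢ ∘ Φ
  prefix-i-fl-j x = T-extensional to from
    where
    to : T (prefix i (fl j τ) x) → T (Sᵢ (Φ x))
    to x∈ with prefix-elim (fl j τ) {x} x∈
    ... | p , p<i , refl = subst (T ∘ Sᵢ)
            (sym (trans (cong Φ (fl-j-below (<-≤-trans p<i i≤j))) (Φ-involutive (τ p))))
            (prefix-intro τ p<i)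
    from : T (Sᵢ (Φ x)) → T (prefix i (fl j τ) x)
    from Φx∈ with prefix-elim τ Φx∈
    ... | p , p<i , τp≡Φx = subst (T ∘ prefix i (fl j τ))
            (trans (fl-j-below (<-≤-trans p<i i≤j)) (trans (cong Φ τp≡Φx) (Φ-involutive x)))
            (prefix-intro (fl j τ) p<i)

  fl-i-fl-j-below : ∀ {p} → toℕ p < j → fl i (fl j τ) p ≡ Φ (fl i τ p)
  fl-i-fl-j-below {p} p<j with toℕ p <? i
  ... | yes p<i = begin
    fl i (fl j τ) p                       ≡⟨ fl-below (fl j τ) size≡i p<i ⟩
    mirror (prefix i (fl j τ)) (fl j τ p) ≡⟨ mirror-cong prefix-i-fl-j (fl j τ p) ⟩
    mirror (Sᵢ ∘ Φ) (fl j τ p)            ≡⟨ cong (mirror (Sᵢ ∘ Φ)) (fl-j-below p<j) ⟩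
    mirror (Sᵢ ∘ Φ) (Φ (τ p))             ≡⟨ mirror-∘ (prefix-intro τ p<i) ⟩
    Φ (mirror Sᵢ (τ p))                   ≡⟨ cong Φ (fl-i-below p<i) ⟨
    Φ (fl i τ p)                          ∎
    where
    open ≡-Reasoning
    size≡i : size (prefix i (fl j τ)) ≡ i
    size≡i = trans (size-cong prefix-i-fl-j) (trans size-∘ (size-prefix (≤-trans i≤j j≤n)))
  ... | no p≮i =
    trans (fl-above (fl j τ) p≮i) (trans (fl-j-below p<j) (cong Φ (sym (fl-above τ p≮i))))

  fl-j-fl-i-below : ∀ {p} → toℕ p < j → fl j (fl i τ) p ≡ Φ (fl i τ p)
  fl-j-fl-i-below {p} p<j = begin
    fl j (fl i τ) p                       ≡⟨ fl-below (fl i τ) size≡j p<j ⟩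
    mirror (prefix j (fl i τ)) (fl i τ p) ≡⟨ mirror-cong prefix-j-fl-i (fl i τ p) ⟩
    mirror Sⱼ (fl i τ p)                  ≡⟨ Φ-∈ (fl-i-∈ p<j) ⟨
    Φ (fl i τ p)                          ∎
    where
    open ≡-Reasoning
    size≡j : size (prefix j (fl i τ)) ≡ j
    size≡j = trans (size-cong prefix-j-fl-i) (size-prefix j≤n)

  fl-comm : ∀ p → fl i (fl j τ) p ≡ fl j (fl i τ) p
  fl-comm p with toℕ p <? j
  ... | yes p<j = trans (fl-i-fl-j-below p<j) (sym (fl-j-fl-i-below p<j))
  ... | no  p≮j = begin
    fl i (fl j τ) p ≡⟨ fl-above (fl j τ) p≮i ⟩
    fl j τ p        ≡⟨ fl-above τ p≮j ⟩
    τ p             ≡⟨ fl-above τ p≮i ⟨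
    fl i τ p        ≡⟨ fl-above (fl i τ) p≮j ⟨
    fl j (fl i τ) p ∎
    where
    open ≡-Reasoning
    p≮i : ¬ toℕ p < i
    p≮i p<i = p≮j (<-≤-trans p<i i≤j)

mainTheorem4 : (n : ℕ) (σ : Permutation′ n) (i j : ℕ) → i ≤ n → j ≤ n →
    (k : Fin n) → fl i (fl j (σ ⟨$⟩ʳ_)) k ≡ fl j (fl i (σ ⟨$⟩ʳ_)) k
mainTheorem4 n σ i j i≤n j≤n k with ≤-total i j
... | inj₁ i≤j = Commutation.fl-comm (σ ⟨$⟩ʳ_) (size-prefix-permutation σ) i≤j j≤n k
... | inj₂ j≤i = sym (Commutation.fl-comm (σ ⟨$⟩ʳ_) (size-prefix-permutation σ) j≤i i≤n k)
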